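{- For all $n \geq 1$, \[ \sum_{\substack{\ell \in \mathcal{L}_n \\ \ell:\, y=\alpha x+\rho,\ \alpha \in (0,1],\ \rho \in [0,1)}} \bigl(\mathbb{Z}_n(\ell) - 1\bigr) = \sum_{i=1}^n \sum_{j=1}^i \varphi(j), \] where $\varphi$ is Euler's totient function.
   Context: For a line $\ell$ in the plane and a real number $k$, $\mathbb{Z}_k(\ell)$ denotes the number of integer points $(i,j) \in \mathbb{Z}\times\mathbb{Z}$ on $\ell$ with $0 \leq i \leq k$. $\mathcal{L}_n$ denotes the set of lines $\ell$ with equation $y = \alpha x + \rho$ where $\alpha \in [0,1]$, $\rho \in [0,1]$ and $\mathbb{Z}_n(\ell) \geq 2$. -}

module Defs where

open import Data.Nat as ℕ using (ℕ; zero; suc)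
open import Data.Nat.GCD using (gcd)
import Data.Nat.Coprimality as C
open import Data.Integer as ℤ using (ℤ; +_)
open import Data.Rational as ℚ using (ℚ; mkℚ; _/_; 0ℚ; 1ℚ)
open import Data.Rational.Properties using (_≟_)
open import Data.Product using (Σ; ∃; _×_; _,_; proj₁; proj₂)
open import Data.List using (List; upTo; filter; length; map)
open import Data.Nat.ListAction using (sum)
open import Relation.Nullary using (Dec; yes; no; ¬_)
open import Relation.Binary.PropositionalEquality using (_≡_; refl; cong)

-- A line  y = α x + ρ  is represented by its pair (α , ρ) of rational
-- coefficients.  (Lines with at least two integer points have rational
-- slope and intercept, so nothing is lost.)
Line : Set
Line = ℚ × ℚ

ι : ℤ → ℚ
ι j = mkℚ j 0 (C.sym (C.1-coprimeTo ℤ.∣ j ∣))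

OnLine : Line → ℤ → ℤ → Set
OnLine (α , ρ) i j = α ℚ.* ι i ℚ.+ ρ ≡ ι j

HasIntPointAt : Line → ℤ → Set
HasIntPointAt ℓ i = ∃ λ (j : ℤ) → OnLine ℓ i j

private
  isInt? : (q : ℚ) → Dec (∃ λ (j : ℤ) → q ≡ ι j)
  isInt? (mkℚ n zero c) = yes (n , refl)
  isInt? (mkℚ n (suc d) c) = no λ { (j , ()) }

hasIntPointAt? : (ℓ : Line) (i : ℤ) → Dec (HasIntPointAt ℓ i)
hasIntPointAt? (α , ρ) i = isInt? (α ℚ.* ι i ℚ.+ ρ)

-- ℤ_n(ℓ): number of integer points (i , j) on ℓ with 0 ≤ i ≤ n.
-- For fixed i there is at most one j, so this counts the abscissae
-- i ∈ {0,…,n} admitting an integer point.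
Zn : ℕ → Line → ℕ
Zn n ℓ = length (filter (λ i → hasIntPointAt? ℓ (+ i)) (upTo (suc n)))

InRange : ℕ → Line → Set
InRange n (α , ρ) =
  (0ℚ ℚ.< α) × (α ℚ.≤ 1ℚ) × (0ℚ ℚ.≤ ρ) × (ρ ℚ.< 1ℚ) × (2 ℕ.≤ Zn n (α , ρ))

φ : ℕ → ℕ
φ j = length (filter (λ k → gcd (suc k) j ℕ.≟ 1) (upTo j))

Σ[1…_] : ℕ → (ℕ → ℕ) → ℕ
Σ[1… n ] f = sum (map (λ i → f (suc i)) (upTo n))

module Submission where

-- Write α = p/q in lowest terms.  The integer abscissae of ℓ form an arithmetic
-- progression of difference q, so exactly one of them lies in [0,q) and
--   ℤ_n(ℓ) − 1 = #{ c ≤ n : ℓ has an integer point at c, q ≤ c }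
--              = Σ_{c ≤ n} Σ_{q₁ < c} [integer point at c and q = q₁ + 1]      (Zn-pred).
-- Exchanging the order of summation, it remains to count, for q ≤ c ≤ n, the
-- lines of the range through an integer point at c whose slope has denominator
-- q.  Such a line is determined by its slope k/q with gcd(k,q) = 1, because
-- ρ ∈ [0,1) is then forced to be ((q − k)·c mod q)/q; so there are φ(q) of them
-- (count-lines), and  Σ_{c ≤ n} Σ_{q ≤ c} φ(q) = Σ_{i=1}^n Σ_{j=1}^i φ(j).

open import Defs
open import Data.Nat using (ℕ; _≤_; _∸_)
open import Data.List using (List; map)
open import Data.Nat.ListAction using (sum)
open import Data.List.Membership.Propositional using (_∈_)
open import Data.List.Relation.Unary.Unique.Propositional using (Unique)
open import Function.Bundles using (_⇔_)
open import Relation.Binary.PropositionalEquality using (_≡_)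

open import Level using (Level)
open import Data.Nat as ℕ using (zero; suc; _+_; _*_; _<_; z≤n; s≤s; _%_; _/_; _≟_; _≤?_; _<?_)
import Data.Nat.Properties as ℕP
open import Data.Nat.DivMod using (m≡m%n+[m/n]*n; m%n<n; m%n≤m)
open import Data.Nat.Divisibility using (_∣_; divides; >⇒∤; ∣m+n∣m⇒∣n; n∣m*n; m∣m*n; m*n∣⇒n∣; *-cancelʳ-∣; *-monoˡ-∣)
open import Data.Nat.GCD using (gcd)
open import Data.Nat.Coprimality as Coprimality using (Coprime; coprime-divisor)
open import Data.Nat.Tactic.RingSolver using (solve-∀)
open import Data.Integer as ℤ using (ℤ; +_; -[1+_])
import Data.Integer.Properties as ℤP
open import Data.Rational as ℚ using (ℚ; mkℚ; toℚᵘ; 0ℚ; 1ℚ; *<*; *≤*)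
open import Data.Rational.Properties
  using (normalize-coprime; toℚᵘ-fromℚᵘ; toℚᵘ-injective; toℚᵘ-cong; toℚᵘ-cancel-≤; toℚᵘ-cancel-<; toℚᵘ-homo-+; toℚᵘ-homo-*)
open import Data.Rational.Unnormalised as ℚᵘ using (ℚᵘ; mkℚᵘ; _≃_; *≡*)
import Data.Rational.Unnormalised.Properties as ℚᵘP
open import Data.List using ([]; _∷_; upTo; filter; length; [_])
open import Data.List.Properties using (map-upTo; map-applyUpTo; length-map)
open import Data.List.Membership.Propositional.Properties
  using (∈-filter⁺; ∈-filter⁻; ∈-upTo⁺; ∈-upTo⁻; ∈-length; ∈-map⁺; ∈-map⁻)
open import Data.List.Membership.Propositional.Properties.WithK using (unique∧set⇒bag)
open import Data.List.Relation.Unary.Any using (here; there)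
open import Data.List.Relation.Unary.All using ([])
open import Data.List.Relation.Unary.AllPairs using ([]; _∷_)
open import Data.List.Relation.Unary.Unique.Propositional.Properties using (filter⁺; map⁺; upTo⁺)
open import Data.List.Relation.Binary.BagAndSetEquality using (∼bag⇒↭)
open import Data.List.Relation.Binary.Permutation.Propositional.Properties using (↭-length)
open import Data.Product using (∃; _×_; _,_; proj₁; proj₂)
open import Data.Sum using (inj₁; inj₂)
open import Function.Bundles using (mk⇔; Equivalence)
open import Relation.Nullary using (Dec; yes; no; ¬_; contradiction)
open import Relation.Nullary.Decidable using (_×-dec_)
open import Relation.Unary using (Decidable)
open import Relation.Binary.PropositionalEquality using (_≢_; refl; sym; trans; cong; cong₂; subst; subst₂; module ≡-Reasoning)

private variable
  la lp lq : Level
  A B : Set la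

𝟙 : {P : Set lp} → Dec P → ℕ
𝟙 (yes _) = 1
𝟙 (no _)  = 0

𝟙-yes : {P : Set lp} → P → (P? : Dec P) → 𝟙 P? ≡ 1
𝟙-yes x (yes _) = refl
𝟙-yes x (no ¬x) = contradiction x ¬x

𝟙-no : {P : Set lp} → ¬ P → (P? : Dec P) → 𝟙 P? ≡ 0
𝟙-no ¬x (yes x) = contradiction x ¬x
𝟙-no ¬x (no _)  = refl

𝟙-× : {P : Set lp} {Q : Set lq} (P? : Dec P) (Q? : Dec Q) → 𝟙 (P? ×-dec Q?) ≡ 𝟙 P? * 𝟙 Q?
𝟙-× (yes _) (yes _) = refl
𝟙-× (yes _) (no _)  = refl
𝟙-× (no _)  _       = refl

𝟙-≤+𝟙-> : (m c : ℕ) → 𝟙 (m ≤? c) + 𝟙 (c <? m) ≡ 1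
𝟙-≤+𝟙-> m c with m ≤? c
... | yes m≤c = cong suc (𝟙-no (ℕP.≤⇒≯ m≤c) (c <? m))
... | no m≰c  = 𝟙-yes (ℕP.≰⇒> m≰c) (c <? m)

length-filter : {P : A → Set lp} (P? : Decidable P) (xs : List A) →
                length (filter P? xs) ≡ sum (map (λ x → 𝟙 (P? x)) xs)
length-filter P? [] = refl
length-filter P? (x ∷ xs) with P? x
... | yes _ = cong suc (length-filter P? xs)
... | no _  = length-filter P? xs

length-unique : {xs ys : List A} → Unique xs → Unique ys →
                (∀ z → z ∈ xs ⇔ z ∈ ys) → length xs ≡ length ys
length-unique uxs uys same = ↭-length (∼bag⇒↭ (unique∧set⇒bag uxs uys (λ {z} → same z)))

sum-cong-∈ : (f g : A → ℕ) (xs : List A) → (∀ x → x ∈ xs → f x ≡ g x) →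
             sum (map f xs) ≡ sum (map g xs)
sum-cong-∈ f g []       _  = refl
sum-cong-∈ f g (x ∷ xs) eq = cong₂ _+_ (eq x (here refl)) (sum-cong-∈ f g xs (λ y y∈ → eq y (there y∈)))

sum-+ : (f g : A → ℕ) (xs : List A) →
        sum (map (λ x → f x + g x) xs) ≡ sum (map f xs) + sum (map g xs)
sum-+ f g []       = refl
sum-+ f g (x ∷ xs) = trans (cong (λ z → f x + g x + z) (sum-+ f g xs)) (interchange (f x) (g x) _ _)
  where
  interchange : ∀ a b c d → a + b + (c + d) ≡ a + c + (b + d)
  interchange = solve-∀

sum-zero : (xs : List A) → sum (map (λ _ → 0) xs) ≡ 0
sum-zero []       = refl
sum-zero (_ ∷ xs) = sum-zero xs

sum-*ˡ : (k : ℕ) (f : A → ℕ) (xs : List A) → k * sum (map f xs) ≡ sum (map (λ x → k * f x) xs)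
sum-*ˡ k f []       = ℕP.*-zeroʳ k
sum-*ˡ k f (x ∷ xs) = trans (ℕP.*-distribˡ-+ k (f x) _) (cong (λ z → k * f x + z) (sum-*ˡ k f xs))

sum-swap : (g : A → B → ℕ) (xs : List A) (ys : List B) →
           sum (map (λ x → sum (map (g x) ys)) xs) ≡ sum (map (λ y → sum (map (λ x → g x y) xs)) ys)
sum-swap g []       ys = sym (sum-zero ys)
sum-swap g (x ∷ xs) ys = trans (cong (λ z → sum (map (g x) ys) + z) (sum-swap g xs ys))
                               (sym (sum-+ (g x) (λ y → sum (map (λ x → g x y) xs)) ys))

Σ< : ℕ → (ℕ → ℕ) → ℕ
Σ< N f = sum (map f (upTo N))

Σ<-cong : (N : ℕ) (f g : ℕ → ℕ) → (∀ i → i < N → f i ≡ g i) → Σ< N f ≡ Σ< N g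
Σ<-cong N f g eq = sum-cong-∈ f g (upTo N) (λ i i∈ → eq i (∈-upTo⁻ i∈))

Σ<-shift : (N : ℕ) (f : ℕ → ℕ) → Σ< (suc N) f ≡ f 0 + Σ< N (λ i → f (suc i))
Σ<-shift N f = cong (λ z → f 0 + z) (cong sum (trans (map-applyUpTo suc f N) (sym (map-upTo (λ i → f (suc i)) N))))

module _ {P : ℕ → Set lp} (P? : Decidable P) where

  count : ℕ → ℕ
  count N = length (filter P? (upTo N))

  ∈-count⁺ : ∀ {N z} → z < N → P z → z ∈ filter P? (upTo N)
  ∈-count⁺ z<N pz = ∈-filter⁺ P? (∈-upTo⁺ z<N) pz

  ∈-count⁻ : ∀ {N z} → z ∈ filter P? (upTo N) → z < N × P z
  ∈-count⁻ z∈ with ∈-filter⁻ P? z∈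
  ... | z∈upTo , pz = ∈-upTo⁻ z∈upTo , pz

  count≡Σ𝟙 : (N : ℕ) → count N ≡ Σ< N (λ i → 𝟙 (P? i))
  count≡Σ𝟙 N = length-filter P? (upTo N)

  count-witness : ∀ {N} → 1 ≤ count N → ∃ λ c → c < N × P c
  count-witness {N} pos with filter P? (upTo N) in eq
  ... | c ∷ _ = c , ∈-count⁻ (subst (c ∈_) (sym eq) (here refl))

  count-zero : ∀ {N} → (∀ {i} → i < N → ¬ P i) → count N ≡ 0
  count-zero none = ℕP.n<1⇒n≡0 (ℕP.≰⇒> λ pos → let (c , c<N , pc) = count-witness pos in none c<N pc)

  count≥2 : ∀ {N a b} → a < N → b < N → a ≢ b → P a → P b → 2 ≤ count N
  count≥2 a<N b<N a≢b pa pb = two-members (∈-count⁺ a<N pa) (∈-count⁺ b<N pb) a≢b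
    where
    two-members : ∀ {xs : List ℕ} {x y} → x ∈ xs → y ∈ xs → x ≢ y → 2 ≤ length xs
    two-members (here refl) (here refl) x≢y = contradiction refl x≢y
    two-members (here _)    (there y∈)  _   = s≤s (∈-length y∈)
    two-members (there x∈)  _           _   = s≤s (∈-length x∈)

  count≡1 : ∀ {N x} → x < N → P x → (∀ {y} → y < N → P y → y ≡ x) → count N ≡ 1
  count≡1 {N} {x} x<N px only = length-unique (filter⁺ P? (upTo⁺ N)) ([] ∷ []) same
    where
    same : ∀ z → z ∈ filter P? (upTo N) ⇔ z ∈ [ x ]
    same z = mk⇔ (λ z∈ → let (z<N , pz) = ∈-count⁻ z∈ in here (only z<N pz))
                 (λ { (here refl) → ∈-count⁺ x<N px })

count-denominator : (d N : ℕ) → count (λ i → suc d ≟ suc i) N ≡ 𝟙 (suc d ≤? N)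
count-denominator d N with suc d ≤? N
... | yes d<N = count≡1 (λ i → suc d ≟ suc i) d<N refl (λ _ eq → ℕP.suc-injective (sym eq))
... | no d≮N  = count-zero (λ i → suc d ≟ suc i) (λ { i<N refl → d≮N i<N })

𝟙-split : {X : Set lp} (X? : Dec X) (m c : ℕ) → 𝟙 X? ≡ 𝟙 X? * 𝟙 (m ≤? c) + 𝟙 (X? ×-dec (c <? m))
𝟙-split X? m c = begin
  𝟙 X?                                       ≡⟨ sym (ℕP.*-identityʳ (𝟙 X?)) ⟩
  𝟙 X? * 1                                   ≡⟨ cong (𝟙 X? *_) (sym (𝟙-≤+𝟙-> m c)) ⟩
  𝟙 X? * (𝟙 (m ≤? c) + 𝟙 (c <? m))           ≡⟨ ℕP.*-distribˡ-+ (𝟙 X?) _ _ ⟩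
  𝟙 X? * 𝟙 (m ≤? c) + 𝟙 X? * 𝟙 (c <? m)      ≡⟨ cong (λ z → 𝟙 X? * 𝟙 (m ≤? c) + z) (sym (𝟙-× X? (c <? m))) ⟩
  𝟙 X? * 𝟙 (m ≤? c) + 𝟙 (X? ×-dec (c <? m))  ∎
  where open ≡-Reasoning

∣∧<⇒≡0 : ∀ {q d} → q ∣ d → d < q → d ≡ 0
∣∧<⇒≡0 {d = zero}  _   _   = refl
∣∧<⇒≡0 {d = suc _} q∣d d<q = contradiction q∣d (>⇒∤ d<q)

module _ {q : ℕ} (R : ℕ → Set) (period : ∀ {u} d → R u → R (u + d) → q ∣ d) where

  private
    unique-ordered : ∀ {u v} → u ≤ v → v < q → R u → R v → u ≡ v
    unique-ordered {u} {v} u≤v v<q ru rv =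
      ℕP.≤-antisym u≤v (ℕP.m∸n≡0⇒m≤n (∣∧<⇒≡0 q∣v∸u (ℕP.≤-<-trans (ℕP.m∸n≤m v u) v<q)))
      where
      q∣v∸u : q ∣ v ∸ u
      q∣v∸u = period (v ∸ u) ru (subst R (sym (ℕP.m+[n∸m]≡n u≤v)) rv)

  unique-below : ∀ {x y} → x < q → y < q → R x → R y → x ≡ y
  unique-below {x} {y} x<q y<q rx ry with ℕP.≤-total x y
  ... | inj₁ x≤y = unique-ordered x≤y y<q rx ry
  ... | inj₂ y≤x = sym (unique-ordered y≤x x<q ry rx)

-- IntegralAt p q₁ a b₁ i :  p·i/q + a/b is an integer, where q = q₁ + 1 and
-- b = b₁ + 1; with cleared denominators,  q·b ∣ p·i·b + a·q.
IntegralAt : (p q₁ a b₁ i : ℕ) → Set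
IntegralAt p q₁ a b₁ i = suc q₁ * suc b₁ ∣ p * i * suc b₁ + a * suc q₁

private
  numerator-shift : ∀ p a i k q b → p * (i + k * q) * b + a * q ≡ p * k * (q * b) + (p * i * b + a * q)
  numerator-shift = solve-∀

  numerator-difference : ∀ p a i d q b → p * (i + d) * b + a * q ≡ (p * i * b + a * q) + p * d * b
  numerator-difference = solve-∀

module _ {p q₁ a b₁ : ℕ} where

  integralAt-down : ∀ {i} k → IntegralAt p q₁ a b₁ (i + k * suc q₁) → IntegralAt p q₁ a b₁ i
  integralAt-down {i} k int = ∣m+n∣m⇒∣n (subst (suc q₁ * suc b₁ ∣_) (numerator-shift p a i k (suc q₁) (suc b₁)) int)
                                        (n∣m*n (p * k))

  integralAt-period : Coprime (suc q₁) p → ∀ {i} d →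
                      IntegralAt p q₁ a b₁ i → IntegralAt p q₁ a b₁ (i + d) → suc q₁ ∣ d
  integralAt-period cop {i} d int-i int-i+d =
    coprime-divisor cop (*-cancelʳ-∣ (suc b₁) (∣m+n∣m⇒∣n (subst (suc q₁ * suc b₁ ∣_) (numerator-difference p a i d (suc q₁) (suc b₁)) int-i+d) int-i))

  integralAt-unique-below : Coprime (suc q₁) p → ∀ {x y} → x < suc q₁ → y < suc q₁ →
                            IntegralAt p q₁ a b₁ x → IntegralAt p q₁ a b₁ y → x ≡ y
  integralAt-unique-below cop = unique-below (IntegralAt p q₁ a b₁) (integralAt-period cop)

  integralAt-intercept : ∀ {c} → IntegralAt p q₁ a b₁ c → a < suc b₁ →
                         ∃ λ t → a * suc q₁ ≡ t * suc b₁ × t < suc q₁ × suc q₁ ∣ p * c + t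
  integralAt-intercept {c} int a<b with ∣m+n∣m⇒∣n (m*n∣⇒n∣ (suc q₁) (suc b₁) int) (n∣m*n (p * c))
  ... | divides t aq≡tb = t , aq≡tb , t<q , *-cancelʳ-∣ (suc b₁) (subst (suc q₁ * suc b₁ ∣_) factor int)
    where
    t<q : t < suc q₁
    t<q = ℕP.*-cancelʳ-< (suc b₁) t (suc q₁) (subst (_< suc q₁ * suc b₁) aq≡tb
            (subst (a * suc q₁ <_) (ℕP.*-comm (suc b₁) (suc q₁)) (ℕP.*-monoˡ-< (suc q₁) a<b)))
    factor : p * c * suc b₁ + a * suc q₁ ≡ (p * c + t) * suc b₁
    factor = trans (cong (λ z → p * c * suc b₁ + z) aq≡tb) (sym (ℕP.*-distribʳ-+ (suc b₁) (p * c) t))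

residue-unique : ∀ {q₁ m t u} → t < suc q₁ → u < suc q₁ → suc q₁ ∣ m + t → suc q₁ ∣ m + u → t ≡ u
residue-unique {q₁} {m} = unique-below (λ t → suc q₁ ∣ m + t) period
  where
  period : ∀ {t} d → suc q₁ ∣ m + t → suc q₁ ∣ m + (t + d) → suc q₁ ∣ d
  period {t} d q∣m+t q∣m+t+d = ∣m+n∣m⇒∣n (subst (suc q₁ ∣_) (sym (ℕP.+-assoc m t d)) q∣m+t+d) q∣m+t

intercept-unique : ∀ {p q₁ c a₁ b₁ a₂ b₂} → a₁ < suc b₁ → a₂ < suc b₂ →
                   IntegralAt p q₁ a₁ b₁ c → IntegralAt p q₁ a₂ b₂ c → a₁ * suc b₂ ≡ a₂ * suc b₁
intercept-unique {p} {q₁} {c} {a₁} {b₁} {a₂} {b₂} a₁<b₁ a₂<b₂ int₁ int₂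
  with integralAt-intercept {p} {q₁} {a₁} {b₁} {c} int₁ a₁<b₁ | integralAt-intercept {p} {q₁} {a₂} {b₂} {c} int₂ a₂<b₂
... | t , a₁q≡tb₁ , t<q , q∣₁ | u , a₂q≡ub₂ , u<q , q∣₂ with residue-unique {q₁} {p * c} t<q u<q q∣₁ q∣₂
... | refl = ℕP.*-cancelʳ-≡ (a₁ * suc b₂) (a₂ * suc b₁) (suc q₁) (begin
      a₁ * suc b₂ * suc q₁   ≡⟨ swap23 a₁ (suc b₂) (suc q₁) ⟩
      a₁ * suc q₁ * suc b₂   ≡⟨ cong (_* suc b₂) a₁q≡tb₁ ⟩
      t * suc b₁ * suc b₂    ≡⟨ swap23 t (suc b₁) (suc b₂) ⟩
      t * suc b₂ * suc b₁    ≡⟨ cong (_* suc b₁) (sym a₂q≡ub₂) ⟩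
      a₂ * suc q₁ * suc b₁   ≡⟨ swap23 a₂ (suc q₁) (suc b₁) ⟩
      a₂ * suc b₁ * suc q₁   ∎)
  where
  open ≡-Reasoning
  swap23 : ∀ x y z → x * y * z ≡ x * z * y
  swap23 = solve-∀

-- The canonical intercept for slope p/q through an integer point at c:
-- the residue r < q with q ∣ p·c + r, namely ((q - p)·c) mod q.
canonicalIntercept : (q₁ p c : ℕ) → ℕ
canonicalIntercept q₁ p c = ((suc q₁ ∸ p) * c) % suc q₁

canonicalIntercept< : ∀ q₁ p c → canonicalIntercept q₁ p c < suc q₁
canonicalIntercept< q₁ p c = m%n<n ((suc q₁ ∸ p) * c) (suc q₁)

integralAt-canonical : ∀ q₁ p c → p ≤ suc q₁ → IntegralAt p q₁ (canonicalIntercept q₁ p c) q₁ c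
integralAt-canonical q₁ p c p≤q =
  subst (q * q ∣_) (ℕP.*-distribʳ-+ q (p * c) r) (*-monoˡ-∣ q q∣pc+r)
  where
  q = suc q₁
  m = (q ∸ p) * c
  r = canonicalIntercept q₁ p c
  pc+m≡qc : p * c + m ≡ q * c
  pc+m≡qc = trans (sym (ℕP.*-distribʳ-+ c p (q ∸ p))) (cong (_* c) (ℕP.m+[n∸m]≡n p≤q))
  rearrange : ∀ x y z → x + (y + z) ≡ y + (z + x)
  rearrange = solve-∀
  q∣pc+r : q ∣ p * c + r
  q∣pc+r = ∣m+n∣m⇒∣n (subst (q ∣_) (sym (trans (rearrange ((m / q) * q) (p * c) r)
                       (trans (cong (λ z → p * c + z) (sym (m≡m%n+[m/n]*n m q))) pc+m≡qc))) (m∣m*n c))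
                     (n∣m*n (m / q))

ordinate : (p q₁ a b₁ i : ℕ) → ℚᵘ
ordinate p q₁ a b₁ i = mkℚᵘ (+ p) q₁ ℚᵘ.* mkℚᵘ (+ i) 0 ℚᵘ.+ mkℚᵘ (+ a) b₁

ordinate-numerator : ∀ p q₁ a b₁ i → ℚᵘ.↥ (ordinate p q₁ a b₁ i) ≡ + (p ℕ.* i ℕ.* suc b₁ ℕ.+ a ℕ.* suc q₁)
ordinate-numerator p q₁ a b₁ i = begin
  (+ p ℤ.* + i) ℤ.* + suc b₁ ℤ.+ + a ℤ.* + suc (q₁ ℕ.* 1)
    ≡⟨ cong₂ (λ x y → x ℤ.* + suc b₁ ℤ.+ y) (sym (ℤP.pos-* p i)) (sym (ℤP.pos-* a (suc (q₁ ℕ.* 1)))) ⟩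
  + (p ℕ.* i) ℤ.* + suc b₁ ℤ.+ + (a ℕ.* suc (q₁ ℕ.* 1))
    ≡⟨ cong (ℤ._+ _) (sym (ℤP.pos-* (p ℕ.* i) (suc b₁))) ⟩
  + (p ℕ.* i ℕ.* suc b₁) ℤ.+ + (a ℕ.* suc (q₁ ℕ.* 1))
    ≡⟨ sym (ℤP.pos-+ (p ℕ.* i ℕ.* suc b₁) (a ℕ.* suc (q₁ ℕ.* 1))) ⟩
  + (p ℕ.* i ℕ.* suc b₁ ℕ.+ a ℕ.* suc (q₁ ℕ.* 1))
    ≡⟨ cong (λ z → + (p ℕ.* i ℕ.* suc b₁ ℕ.+ a ℕ.* suc z)) (ℕP.*-identityʳ q₁) ⟩
  + (p ℕ.* i ℕ.* suc b₁ ℕ.+ a ℕ.* suc q₁) ∎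
  where open ≡-Reasoning

ordinate-denominator : ∀ p q₁ a b₁ i → ℚᵘ.↧ (ordinate p q₁ a b₁ i) ≡ + (suc q₁ ℕ.* suc b₁)
ordinate-denominator p q₁ a b₁ i = cong (λ z → + (suc z ℕ.* suc b₁)) (ℕP.*-identityʳ q₁)

intPoint⇔integralAt : ∀ {α ρ p q₁ a b₁} → toℚᵘ α ≃ mkℚᵘ (+ p) q₁ → toℚᵘ ρ ≃ mkℚᵘ (+ a) b₁ →
                      ∀ i → HasIntPointAt (α , ρ) (+ i) ⇔ IntegralAt p q₁ a b₁ i
intPoint⇔integralAt {α} {ρ} {p} {q₁} {a} {b₁} α≃ ρ≃ i = mk⇔ to from
  where
  N = p ℕ.* i ℕ.* suc b₁ ℕ.+ a ℕ.* suc q₁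
  M = suc q₁ ℕ.* suc b₁
  value≃ : toℚᵘ (α ℚ.* ι (+ i) ℚ.+ ρ) ≃ ordinate p q₁ a b₁ i
  value≃ = ℚᵘP.≃-trans (toℚᵘ-homo-+ (α ℚ.* ι (+ i)) ρ)
             (ℚᵘP.+-cong (ℚᵘP.≃-trans (toℚᵘ-homo-* α (ι (+ i))) (ℚᵘP.*-cong α≃ ℚᵘP.≃-refl)) ρ≃)
  to : HasIntPointAt (α , ρ) (+ i) → IntegralAt p q₁ a b₁ i
  to (j , on) with ℚᵘP.≃-trans (ℚᵘP.≃-sym value≃) (toℚᵘ-cong on)
  ... | *≡* cross = divides ℤ.∣ j ∣ (trans (cong ℤ.∣_∣ N≡jM) (ℤP.abs-* j (+ M)))
    where
    N≡jM : + N ≡ j ℤ.* + M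
    N≡jM = trans (sym (ordinate-numerator p q₁ a b₁ i))
             (trans (sym (ℤP.*-identityʳ _)) (trans cross (cong (j ℤ.*_) (ordinate-denominator p q₁ a b₁ i))))
  from : IntegralAt p q₁ a b₁ i → HasIntPointAt (α , ρ) (+ i)
  from (divides k N≡kM) = + k , toℚᵘ-injective (ℚᵘP.≃-trans value≃ (*≡* cross))
    where
    cross : ℚᵘ.↥ (ordinate p q₁ a b₁ i) ℤ.* + 1 ≡ + k ℤ.* ℚᵘ.↧ (ordinate p q₁ a b₁ i)
    cross = trans (ℤP.*-identityʳ _) (trans (ordinate-numerator p q₁ a b₁ i)
              (trans (cong +_ N≡kM) (trans (ℤP.pos-* k M) (cong (+ k ℤ.*_) (sym (ordinate-denominator p q₁ a b₁ i))))))

denominator : Line → ℕ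
denominator (α , _) = ℚ.↧ₙ α

IntPointAt : Line → ℕ → Set
IntPointAt ℓ i = HasIntPointAt ℓ (+ i)

intPointAt? : (ℓ : Line) (i : ℕ) → Dec (IntPointAt ℓ i)
intPointAt? ℓ i = hasIntPointAt? ℓ (+ i)

record Coefficients (ℓ : Line) : Set where
  field
    p q₁ a b₁    : ℕ
    slope≃       : toℚᵘ (proj₁ ℓ) ≃ mkℚᵘ (+ p) q₁
    intercept≃   : toℚᵘ (proj₂ ℓ) ≃ mkℚᵘ (+ a) b₁
    reduced      : Coprime (suc q₁) p
    a<b          : a < suc b₁
    p≤q          : p ≤ suc q₁
    denominator≡ : denominator ℓ ≡ suc q₁

  intPointAt⇔ : ∀ i → IntPointAt ℓ i ⇔ IntegralAt p q₁ a b₁ i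
  intPointAt⇔ = intPoint⇔integralAt slope≃ intercept≃

  toIntegral : ∀ {i} → IntPointAt ℓ i → IntegralAt p q₁ a b₁ i
  toIntegral {i} = Equivalence.to (intPointAt⇔ i)

  fromIntegral : ∀ {i} → IntegralAt p q₁ a b₁ i → IntPointAt ℓ i
  fromIntegral {i} = Equivalence.from (intPointAt⇔ i)

coefficients : ∀ {n} (ℓ : Line) → InRange n ℓ → Coefficients ℓ
coefficients (mkℚ (+ p) q₁ reduced , mkℚ (+ a) b₁ _) (_ , *≤* α≤1 , _ , *<* ρ<1 , _) = record
  { p = p ; q₁ = q₁ ; a = a ; b₁ = b₁
  ; slope≃ = ℚᵘP.≃-refl ; intercept≃ = ℚᵘP.≃-refl
  ; reduced = Coprimality.sym (Coprimality.recompute reduced)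
  ; a<b = ℤP.drop‿+<+ (subst₂ ℤ._<_ (ℤP.*-identityʳ (+ a)) (ℤP.*-identityˡ (+ suc b₁)) ρ<1)
  ; p≤q = ℤP.drop‿+≤+ (subst₂ ℤ._≤_ (ℤP.*-identityʳ (+ p)) (ℤP.*-identityˡ (+ suc q₁)) α≤1)
  ; denominator≡ = refl }
coefficients (mkℚ (+ _) _ _ , mkℚ -[1+ _ ] _ _) (_ , _ , *≤* () , _)
coefficients (mkℚ -[1+ _ ] _ _ , _) (*<* () , _)

-- Among the abscissae 0, …, n exactly one integer point lies below the
-- denominator q: the integer abscissae form a progression of difference q.
lowest-point : ∀ n ℓ → InRange n ℓ → count (λ c → intPointAt? ℓ c ×-dec (c <? denominator ℓ)) (suc n) ≡ 1
lowest-point n ℓ inRange@(_ , _ , _ , _ , two≤Zn) with count-witness (intPointAt? ℓ) (ℕP.≤-trans (s≤s z≤n) two≤Zn)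
... | c , c≤n , int-c =
  count≡1 (λ c → intPointAt? ℓ c ×-dec (c <? denominator ℓ)) x₀≤n (int-x₀ , subst (x₀ <_) (sym denominator≡) x₀<q) only-x₀
  where
  open Coefficients (coefficients ℓ inRange)
  q = suc q₁
  x₀ = c % q
  x₀<q : x₀ < q
  x₀<q = m%n<n c q
  x₀≤n : x₀ < suc n
  x₀≤n = ℕP.≤-<-trans (m%n≤m c q) c≤n
  int-x₀ : IntPointAt ℓ x₀
  int-x₀ = fromIntegral (integralAt-down {p} {q₁} {a} {b₁} (c / q)
             (subst (IntegralAt p q₁ a b₁) (m≡m%n+[m/n]*n c q) (toIntegral int-c)))
  only-x₀ : ∀ {y} → y < suc n → IntPointAt ℓ y × y < denominator ℓ → y ≡ x₀
  only-x₀ {y} _ (int-y , y<d) = integralAt-unique-below {p} {q₁} {a} {b₁} reduced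
                                  (subst (y <_) denominator≡ y<d) x₀<q (toIntegral int-y) (toIntegral int-x₀)

weight : Line → ℕ → ℕ → ℕ
weight ℓ c q₁ = 𝟙 (intPointAt? ℓ c) * 𝟙 (denominator ℓ ≟ suc q₁)

-- Every integer point except the lowest one has abscissa c ≥ q, and is counted
-- exactly once (for q₁ = q − 1) in the double sum below.
Zn-pred : ∀ n ℓ → InRange n ℓ → Zn n ℓ ∸ 1 ≡ Σ< (suc n) (λ c → Σ< c (weight ℓ c))
Zn-pred n ℓ inRange = begin
  Zn n ℓ ∸ 1
    ≡⟨ cong (_∸ 1) (count≡Σ𝟙 (intPointAt? ℓ) (suc n)) ⟩
  Σ< (suc n) (λ c → 𝟙 (H? c)) ∸ 1
    ≡⟨ cong (_∸ 1) (Σ<-cong (suc n) _ _ (λ c _ → 𝟙-split (H? c) (denominator ℓ) c)) ⟩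
  Σ< (suc n) (λ c → 𝟙 (H? c) * 𝟙 (denominator ℓ ≤? c) + 𝟙 (L? c)) ∸ 1
    ≡⟨ cong (_∸ 1) (sum-+ (λ c → 𝟙 (H? c) * 𝟙 (denominator ℓ ≤? c)) (λ c → 𝟙 (L? c)) (upTo (suc n))) ⟩
  Σ< (suc n) (λ c → 𝟙 (H? c) * 𝟙 (denominator ℓ ≤? c)) + Σ< (suc n) (λ c → 𝟙 (L? c)) ∸ 1
    ≡⟨ cong (λ z → Σ< (suc n) (λ c → 𝟙 (H? c) * 𝟙 (denominator ℓ ≤? c)) + z ∸ 1)
            (trans (sym (count≡Σ𝟙 L? (suc n))) (lowest-point n ℓ inRange)) ⟩
  Σ< (suc n) (λ c → 𝟙 (H? c) * 𝟙 (denominator ℓ ≤? c)) + 1 ∸ 1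
    ≡⟨ ℕP.m+n∸n≡m _ 1 ⟩
  Σ< (suc n) (λ c → 𝟙 (H? c) * 𝟙 (denominator ℓ ≤? c))
    ≡⟨ Σ<-cong (suc n) _ _ (λ c _ → cong (𝟙 (H? c) *_) (sym (denominator-count c))) ⟩
  Σ< (suc n) (λ c → 𝟙 (H? c) * Σ< c (λ q₁ → 𝟙 (denominator ℓ ≟ suc q₁)))
    ≡⟨ Σ<-cong (suc n) _ _ (λ c _ → sum-*ˡ (𝟙 (H? c)) _ (upTo c)) ⟩
  Σ< (suc n) (λ c → Σ< c (weight ℓ c)) ∎
  where
  open ≡-Reasoning
  H? = intPointAt? ℓ
  L? = λ c → H? c ×-dec (c <? denominator ℓ)
  denominator-count : ∀ c → Σ< c (λ q₁ → 𝟙 (denominator ℓ ≟ suc q₁)) ≡ 𝟙 (denominator ℓ ≤? c)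
  denominator-count c = trans (sym (count≡Σ𝟙 (λ q₁ → denominator ℓ ≟ suc q₁) c))
                              (count-denominator (ℚ.denominator-1 (proj₁ ℓ)) c)

frac : ℕ → ℕ → ℚ
frac a q₁ = + a ℚ./ suc q₁

frac≃ : ∀ a q₁ → toℚᵘ (frac a q₁) ≃ mkℚᵘ (+ a) q₁
frac≃ a q₁ = toℚᵘ-fromℚᵘ (mkℚᵘ (+ a) q₁)

frac-reduced : ∀ {a q₁} .(cop : Coprime a (suc q₁)) → frac a q₁ ≡ mkℚ (+ a) q₁ cop
frac-reduced cop = normalize-coprime cop

frac-injective : ∀ {a a′ q₁} → frac a q₁ ≡ frac a′ q₁ → a ≡ a′
frac-injective {a} {a′} {q₁} eq with ℚᵘP.≃-trans (ℚᵘP.≃-sym (frac≃ a q₁)) (ℚᵘP.≃-trans (toℚᵘ-cong eq) (frac≃ a′ q₁))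
... | *≡* cross = ℤP.+-injective (ℤP.*-cancelʳ-≡ (+ a) (+ a′) (+ suc q₁) cross)

frac-nonneg : ∀ a q₁ → 0ℚ ℚ.≤ frac a q₁
frac-nonneg a q₁ = toℚᵘ-cancel-≤ (ℚᵘP.≤-respʳ-≃ (ℚᵘP.≃-sym (frac≃ a q₁))
                     (ℚᵘ.*≤* (subst (+ 0 ℤ.≤_) (sym (ℤP.*-identityʳ (+ a))) (ℤ.+≤+ z≤n))))

frac-pos : ∀ a q₁ → 0ℚ ℚ.< frac (suc a) q₁
frac-pos a q₁ = toℚᵘ-cancel-< (ℚᵘP.<-respʳ-≃ (ℚᵘP.≃-sym (frac≃ (suc a) q₁))
                  (ℚᵘ.*<* (subst (+ 0 ℤ.<_) (sym (ℤP.*-identityʳ (+ suc a))) (ℤ.+<+ (s≤s z≤n)))))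

frac≤1 : ∀ {a q₁} → a ≤ suc q₁ → frac a q₁ ℚ.≤ 1ℚ
frac≤1 {a} {q₁} a≤q = toℚᵘ-cancel-≤ (ℚᵘP.≤-respˡ-≃ (ℚᵘP.≃-sym (frac≃ a q₁))
                        (ℚᵘ.*≤* (subst₂ ℤ._≤_ (sym (ℤP.*-identityʳ (+ a))) (sym (ℤP.*-identityˡ (+ suc q₁))) (ℤ.+≤+ a≤q))))

frac<1 : ∀ {a q₁} → a < suc q₁ → frac a q₁ ℚ.< 1ℚ
frac<1 {a} {q₁} a<q = toℚᵘ-cancel-< (ℚᵘP.<-respˡ-≃ (ℚᵘP.≃-sym (frac≃ a q₁))
                        (ℚᵘ.*<* (subst₂ ℤ._<_ (sym (ℤP.*-identityʳ (+ a))) (sym (ℤP.*-identityˡ (+ suc q₁))) (ℤ.+<+ a<q))))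

lineThrough : (q₁ c k : ℕ) → Line
lineThrough q₁ c k = frac (suc k) q₁ , frac (canonicalIntercept q₁ (suc k) c) q₁

lineThrough-injective : ∀ q₁ c {k k′} → lineThrough q₁ c k ≡ lineThrough q₁ c k′ → k ≡ k′
lineThrough-injective q₁ c eq = ℕP.suc-injective (frac-injective (cong proj₁ eq))

-- The numerators k + 1 ∈ [1, q] of reduced fractions with denominator q;
-- by definition φ q is the length of this list.
coprimeResidues : ℕ → List ℕ
coprimeResidues q = filter (λ k → gcd (suc k) q ≟ 1) (upTo q)

lineThrough-valid : ∀ {n q₁ c k} → k < suc q₁ → gcd (suc k) (suc q₁) ≡ 1 → suc q₁ ≤ c → c ≤ n →
                    InRange n (lineThrough q₁ c k) × IntPointAt (lineThrough q₁ c k) c × denominator (lineThrough q₁ c k) ≡ suc q₁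
lineThrough-valid {n} {q₁} {c} {k} k<q gcd≡1 q≤c c≤n =
  (frac-pos k q₁ , frac≤1 k<q , frac-nonneg r q₁ , frac<1 (canonicalIntercept< q₁ (suc k) c) , two-points) ,
  fromIntegral {c} int-c ,
  cong ℚ.↧ₙ_ (frac-reduced {suc k} {q₁} (Coprimality.gcd≡1⇒coprime gcd≡1))
  where
  q = suc q₁
  r = canonicalIntercept q₁ (suc k) c
  fromIntegral : ∀ {i} → IntegralAt (suc k) q₁ r q₁ i → IntPointAt (lineThrough q₁ c k) i
  fromIntegral {i} = Equivalence.from (intPoint⇔integralAt (frac≃ (suc k) q₁) (frac≃ r q₁) i)
  int-c : IntegralAt (suc k) q₁ r q₁ c
  int-c = integralAt-canonical q₁ (suc k) c k<q
  c-q+q≡c : c ∸ q + 1 * q ≡ c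
  c-q+q≡c = trans (cong (λ z → c ∸ q + z) (ℕP.*-identityˡ q)) (ℕP.m∸n+n≡m q≤c)
  int-c-q : IntegralAt (suc k) q₁ r q₁ (c ∸ q)
  int-c-q = integralAt-down {suc k} {q₁} {r} {q₁} {c ∸ q} 1 (subst (IntegralAt (suc k) q₁ r q₁) (sym c-q+q≡c) int-c)
  c-q<c : c ∸ q < c
  c-q<c = ℕP.∸-monoʳ-< {c} {q} {0} (s≤s z≤n) q≤c
  two-points : 2 ≤ Zn n (lineThrough q₁ c k)
  two-points = count≥2 (intPointAt? (lineThrough q₁ c k)) (ℕP.<-trans c-q<c (s≤s c≤n)) (s≤s c≤n)
                 (ℕP.<⇒≢ c-q<c) (fromIntegral {c ∸ q} int-c-q) (fromIntegral {c} int-c)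

lineThrough-complete : ∀ {n q₁ c} ℓ → InRange n ℓ → IntPointAt ℓ c → denominator ℓ ≡ suc q₁ →
                       ∃ λ k → k ∈ coprimeResidues (suc q₁) × ℓ ≡ lineThrough q₁ c k
lineThrough-complete (mkℚ (+ zero) _ _ , _) (*<* (ℤ.+<+ ()) , _) _ _
lineThrough-complete (mkℚ -[1+ _ ] _ _ , _) (*<* () , _) _ _
lineThrough-complete (mkℚ (+ _) _ _ , mkℚ -[1+ _ ] _ _) (_ , _ , *≤* () , _) _ _
lineThrough-complete {n} {q₁} {c} ℓ@(mkℚ (+ suc k) _ cop , mkℚ (+ a) b₁ _) inRange@(_ , *≤* _ , _ , *<* _ , _) int-c refl =
  k , ∈-filter⁺ (λ k → gcd (suc k) (suc q₁) ≟ 1) (∈-upTo⁺ p≤q) gcd≡1 ,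
  cong₂ _,_ (sym (frac-reduced cop)) intercept≡
  where
  open Coefficients (coefficients ℓ inRange) using (p≤q; a<b; toIntegral)
  gcd≡1 : gcd (suc k) (suc q₁) ≡ 1
  gcd≡1 = Coprimality.coprime⇒gcd≡1 (Coprimality.recompute cop)
  r = canonicalIntercept q₁ (suc k) c
  cross : a * suc q₁ ≡ r * suc b₁
  cross = intercept-unique {suc k} {q₁} {c} {a} {b₁} {r} {q₁} a<b (canonicalIntercept< q₁ (suc k) c) (toIntegral {c} int-c) (integralAt-canonical q₁ (suc k) c p≤q)
  intercept≡ : proj₂ ℓ ≡ frac r q₁
  intercept≡ = toℚᵘ-injective (ℚᵘP.≃-trans (*≡* (trans (sym (ℤP.pos-* a (suc q₁))) (trans (cong +_ cross) (ℤP.pos-* r (suc b₁)))))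
                                           (ℚᵘP.≃-sym (frac≃ r q₁)))

count-lines : ∀ n (ls : List Line) → Unique ls → (∀ ℓ → (ℓ ∈ ls) ⇔ InRange n ℓ) →
              ∀ {c q₁} → c ≤ n → q₁ < c → sum (map (λ ℓ → weight ℓ c q₁) ls) ≡ φ (suc q₁)
count-lines n ls unique-ls ls≡range {c} {q₁} c≤n q<c = begin
  sum (map (λ ℓ → weight ℓ c q₁) ls)
    ≡⟨ sum-cong-∈ (λ ℓ → weight ℓ c q₁) (λ ℓ → 𝟙 (Through? ℓ)) ls (λ ℓ _ → sym (𝟙-× (intPointAt? ℓ c) (denominator ℓ ≟ suc q₁))) ⟩
  sum (map (λ ℓ → 𝟙 (Through? ℓ)) ls)
    ≡⟨ sym (length-filter Through? ls) ⟩
  length (filter Through? ls)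
    ≡⟨ length-unique (filter⁺ Through? unique-ls) unique-lines (λ ℓ → mk⇔ (to ℓ) (from ℓ)) ⟩
  length (map (lineThrough q₁ c) (coprimeResidues (suc q₁)))
    ≡⟨ length-map (lineThrough q₁ c) (coprimeResidues (suc q₁)) ⟩
  φ (suc q₁) ∎
  where
  open ≡-Reasoning
  Through? = λ ℓ → intPointAt? ℓ c ×-dec (denominator ℓ ≟ suc q₁)
  lines = map (lineThrough q₁ c) (coprimeResidues (suc q₁))
  unique-lines : Unique lines
  unique-lines = map⁺ (lineThrough-injective q₁ c) (filter⁺ (λ k → gcd (suc k) (suc q₁) ≟ 1) (upTo⁺ (suc q₁)))
  to : ∀ ℓ → ℓ ∈ filter Through? ls → ℓ ∈ lines
  to ℓ ℓ∈ =
    let (ℓ∈ls , int-c , denom≡) = ∈-filter⁻ Through? ℓ∈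
        (k , k∈ , ℓ≡line) = lineThrough-complete ℓ (Equivalence.to (ls≡range ℓ) ℓ∈ls) int-c denom≡
    in subst (_∈ lines) (sym ℓ≡line) (∈-map⁺ (lineThrough q₁ c) k∈)
  from : ∀ ℓ → ℓ ∈ lines → ℓ ∈ filter Through? ls
  from ℓ ℓ∈ =
    let (k , k∈ , ℓ≡line) = ∈-map⁻ (lineThrough q₁ c) ℓ∈
        (k∈upTo , gcd≡1) = ∈-filter⁻ (λ k → gcd (suc k) (suc q₁) ≟ 1) k∈
        (inRange , int-c , denom≡) = lineThrough-valid {n} {q₁} {c} {k} (∈-upTo⁻ k∈upTo) gcd≡1 q<c c≤n
    in subst (_∈ filter Through? ls) (sym ℓ≡line)
             (∈-filter⁺ Through? (Equivalence.from (ls≡range (lineThrough q₁ c k)) inRange) (int-c , denom≡))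

lemma3p3 : (n : ℕ) → 1 ≤ n → (ls : List Line) → Unique ls → (∀ ℓ → (ℓ ∈ ls) ⇔ InRange n ℓ) → sum (map (λ ℓ → Zn n ℓ ∸ 1) ls) ≡ Σ[1… n ] (λ i → Σ[1… i ] φ)
lemma3p3 n _ ls unique-ls ls≡range = begin
  sum (map (λ ℓ → Zn n ℓ ∸ 1) ls)
    ≡⟨ sum-cong-∈ _ _ ls (λ ℓ ℓ∈ → Zn-pred n ℓ (Equivalence.to (ls≡range ℓ) ℓ∈)) ⟩
  sum (map (λ ℓ → Σ< (suc n) (λ c → Σ< c (weight ℓ c))) ls)
    ≡⟨ sum-swap (λ ℓ c → Σ< c (weight ℓ c)) ls (upTo (suc n)) ⟩
  Σ< (suc n) (λ c → sum (map (λ ℓ → Σ< c (weight ℓ c)) ls))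
    ≡⟨ Σ<-cong (suc n) _ _ (λ c _ → sum-swap (λ ℓ → weight ℓ c) ls (upTo c)) ⟩
  Σ< (suc n) (λ c → Σ< c (λ q₁ → sum (map (λ ℓ → weight ℓ c q₁) ls)))
    ≡⟨ Σ<-cong (suc n) _ _ (λ c c≤n → Σ<-cong c _ _ (λ q₁ q₁<c →
         count-lines n ls unique-ls ls≡range (ℕP.≤-pred c≤n) q₁<c)) ⟩
  Σ< (suc n) (λ c → Σ< c (λ q₁ → φ (suc q₁)))
    ≡⟨ Σ<-shift n (λ c → Σ< c (λ q₁ → φ (suc q₁))) ⟩
  Σ[1… n ] (λ i → Σ[1… i ] φ) ∎
  where open ≡-Reasoning
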